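{- Let $n\ge 0$ and $m>1$ be integers. Let $Y\subseteq D_n$ satisfy $\pi(Y)=Y$ for every permutation $\pi\in S_n$, and let $x,y\in D_n$ with $x\sim y$. Then: (1) $G(\{x\}\times Y)=G(\{y\}\times Y)$; (2) $G([x]\times Y)=\gamma(x)\cdot G(\{x\}\times Y)$; (3) if $m$ divides $\gamma(x)$, then $m$ divides $G([x]\times Y)$; (4) $m$ divides $G(E_{n,m}\times Y)$ and $G(Y\times E_{n,m})$.
   Context: $D_n$ is the set of monotone Boolean functions $\{0,1\}^n\to\{0,1\}$ ($\{0,1\}^n$ ordered componentwise), partially ordered pointwise. $\top$ and $\bot$ are the constant functions $1$ and $0$. For $x,y\in D_n$, $x|y$ and $x\& y$ are the pointwise maximum (bitwise or) and pointwise minimum (bitwise and); $\mathrm{re}(x,y)=|\{z\in D_n: x\le z\le y\}|$. For $x,y\in D_n$ define $G(x,y)=\mathrm{re}(x|y,\top)\cdot\mathrm{re}(\bot,x\& y)$, and for $A\subseteq D_n\times D_n$, $G(A)=\sum_{(x,y)\in A}G(x,y)$. A permutation $\pi\in S_n$ acts on $u\in\{0,1\}^n$ (viewed as a map $\{1,\dots,n\}\to\{0,1\}$) by $\pi(u)=u\circ\pi$, on $g\in D_n$ by $\pi(g)=g\circ\pi$, and on subsets by $\pi(Y)=\{\pi(g):g\in Y\}$. Write $f\sim g$ if $f=\pi(g)$ for some $\pi\in S_n$; $[f]=\{g\in D_n:g\sim f\}$ is the equivalence class and $\gamma(f)=|[f]|$. For $m>1$, $E_{n,m}=\{f\in D_n:\gamma(f)\equiv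 0\pmod m\}$. -}

module Defs where

open import Data.Bool using (Bool; true; false; _∨_; _∧_) renaming (_≤_ to _≤ᵇ_)
open import Data.Bool.Properties using () renaming (_≟_ to _≟ᵇ_; _≤?_ to _≤ᵇ?_)
open import Data.Nat using (ℕ; zero; suc; _*_)
open import Data.Nat.Divisibility using (_∣_; _∣?_)
open import Data.Fin using (Fin)
open import Data.Fin.Properties using () renaming (_≟_ to _≟ᶠ_; all? to allFin?)
open import Data.Vec using (Vec; []; _∷_; lookup; tabulate)
open import Data.Vec.Relation.Binary.Pointwise.Inductive as PW using (Pointwise)
open import Data.Nat.ListAction using (sum)
open import Data.List using (List; []; _∷_; map; filter; length; _++_; allFin; cartesianProduct)
open import Data.List.Relation.Unary.All as All using (All)
open import Data.List.Relation.Unary.Any as Any using (Any; here; there)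
open import Data.List.Membership.Propositional using (_∈_)
open import Data.List.Membership.Propositional.Properties using (∈-map⁺; ∈-++⁺ˡ; ∈-++⁺ʳ; ∈-allFin)
open import Data.Product using (Σ; Σ-syntax; ∃; _×_; _,_; proj₁; proj₂)
open import Data.Product.Properties using (≡-dec)
open import Relation.Nullary using (Dec; yes; no; ¬_)
open import Relation.Nullary.Decidable using (_×-dec_; _→-dec_)
open import Relation.Unary using (Pred; Decidable)
open import Level using (0ℓ)
open import Relation.Binary.Definitions using (DecidableEquality)
open import Relation.Binary.PropositionalEquality using (_≡_; refl)

prependAll : ∀ {A : Set} {k} → List A → List (Vec A k) → List (Vec A (suc k))
prependAll []       vs = []
prependAll (x ∷ xs) vs = map (x ∷_) vs ++ prependAll xs vs

allVecs : ∀ {A : Set} → List A → (k : ℕ) → List (Vec A k)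
allVecs xs zero    = [] ∷ []
allVecs xs (suc k) = prependAll xs (allVecs xs k)

prependAll-∈ : ∀ {A : Set} {k} {x : A} {v : Vec A k} (xs : List A) {vs} →
               x ∈ xs → v ∈ vs → (x ∷ v) ∈ prependAll xs vs
prependAll-∈ (_ ∷ xs) (here refl) v∈ = ∈-++⁺ˡ (∈-map⁺ (_ ∷_) v∈)
prependAll-∈ (y ∷ xs) {vs} (there x∈) v∈ = ∈-++⁺ʳ (map (y ∷_) vs) (prependAll-∈ xs x∈ v∈)

allVecs-complete : ∀ {A : Set} (xs : List A) → (∀ x → x ∈ xs) →
                   ∀ {k} (v : Vec A k) → v ∈ allVecs xs k
allVecs-complete xs c []      = here refl
allVecs-complete xs c (x ∷ v) = prependAll-∈ xs (c x) (allVecs-complete xs c v)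

∀Vec? : ∀ {A : Set} (xs : List A) → (∀ x → x ∈ xs) → ∀ {k} {P : Vec A k → Set} →
        Decidable P → Dec (∀ v → P v)
∀Vec? xs c {k} P? with All.all? P? (allVecs xs k)
... | yes a = yes (λ v → All.lookup a (allVecs-complete xs c v))
... | no ¬a = no (λ h → ¬a (All.tabulate (λ {v} _ → h v)))

∃Vec? : ∀ {A : Set} (xs : List A) → (∀ x → x ∈ xs) → ∀ {k} {P : Vec A k → Set} →
        Decidable P → Dec (Σ (Vec A k) P)
∃Vec? xs c {k} P? with Any.any? P? (allVecs xs k)
... | yes a = yes (Any.satisfied a)
... | no ¬a = no (λ { (v , pv) → ¬a (Any.map (λ { refl → pv }) (allVecs-complete xs c v)) })

Input : ℕ → Set
Input n = Vec Bool n

bools : List Bool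
bools = false ∷ true ∷ []

bools-complete : ∀ b → b ∈ bools
bools-complete false = here refl
bools-complete true  = there (here refl)

∀Input? : ∀ {n} {P : Input n → Set} → Decidable P → Dec (∀ u → P u)
∀Input? = ∀Vec? bools bools-complete

_≤ᵛ_ : ∀ {n} → Input n → Input n → Set
_≤ᵛ_ = Pointwise _≤ᵇ_

_≤ᵛ?_ : ∀ {n} (u v : Input n) → Dec (u ≤ᵛ v)
_≤ᵛ?_ = PW.decidable _≤ᵇ?_

-- A Boolean function on {0,1}^n, stored as its full truth table in
-- Shannon-expansion form: BF (suc n) = (restriction to x₁ = 0 , restriction to x₁ = 1).
BF : ℕ → Set
BF zero    = Bool
BF (suc n) = BF n × BF n

eval : ∀ {n} → BF n → Input n → Bool
eval {zero}  b         []          = b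
eval {suc n} (f₀ , f₁) (false ∷ u) = eval f₀ u
eval {suc n} (f₀ , f₁) (true  ∷ u) = eval f₁ u

tab : ∀ {n} → (Input n → Bool) → BF n
tab {zero}  h = h []
tab {suc n} h = tab (λ u → h (false ∷ u)) , tab (λ u → h (true ∷ u))

_≟BF_ : ∀ {n} → DecidableEquality (BF n)
_≟BF_ {zero}  = _≟ᵇ_
_≟BF_ {suc n} = ≡-dec _≟BF_ _≟BF_

allBF : (n : ℕ) → List (BF n)
allBF zero    = bools
allBF (suc n) = cartesianProduct (allBF n) (allBF n)

Monotone : ∀ {n} → BF n → Set
Monotone f = ∀ u v → u ≤ᵛ v → eval f u ≤ᵇ eval f v

Monotone? : ∀ {n} → Decidable (Monotone {n})
Monotone? f = ∀Input? (λ u → ∀Input? (λ v → (u ≤ᵛ? v) →-dec (eval f u ≤ᵇ? eval f v)))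

D : (n : ℕ) → List (BF n)
D n = filter Monotone? (allBF n)

_≤F_ : ∀ {n} → BF n → BF n → Set
f ≤F g = ∀ u → eval f u ≤ᵇ eval g u

_≤F?_ : ∀ {n} (f g : BF n) → Dec (f ≤F g)
f ≤F? g = ∀Input? (λ u → eval f u ≤ᵇ? eval g u)

⊤F ⊥F : ∀ {n} → BF n
⊤F = tab (λ _ → true)
⊥F = tab (λ _ → false)

_∣F_ _&F_ : ∀ {n} → BF n → BF n → BF n
f ∣F g = tab (λ u → eval f u ∨ eval g u)
f &F g = tab (λ u → eval f u ∧ eval g u)

re : ∀ {n} → BF n → BF n → ℕ
re {n} x y = length (filter (λ z → (x ≤F? z) ×-dec (z ≤F? y)) (D n))

G : ∀ {n} → BF n → BF n → ℕ
G x y = re (x ∣F y) ⊤F * re ⊥F (x &F y)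

-- G(A) for a "rectangle" A = (P ∩ D_n) × (Q ∩ D_n), P, Q decidable subsets
GΣ : ∀ {n} {P Q : Pred (BF n) 0ℓ} → Decidable P → Decidable Q → ℕ
GΣ {n} P? Q? = sum (map (λ x → sum (map (G x) (filter Q? (D n)))) (filter P? (D n)))

Perm : ℕ → Set
Perm n = Vec (Fin n) n

-- bijectivity (for a self-map of a finite set, injectivity)
IsPerm : ∀ {n} → Perm n → Set
IsPerm {n} σ = ∀ (i j : Fin n) → lookup σ i ≡ lookup σ j → i ≡ j

IsPerm? : ∀ {n} → Decidable (IsPerm {n})
IsPerm? σ = allFin? (λ i → allFin? (λ j → (lookup σ i ≟ᶠ lookup σ j) →-dec (i ≟ᶠ j)))

actI : ∀ {n} → Perm n → Input n → Input n
actI σ u = tabulate (λ i → lookup u (lookup σ i))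

act : ∀ {n} → Perm n → BF n → BF n
act σ g = tab (λ u → eval g (actI σ u))

_∼_ : ∀ {n} → BF n → BF n → Set
_∼_ {n} f g = Σ (Perm n) (λ σ → IsPerm σ × f ≡ act σ g)

_∼?_ : ∀ {n} (f g : BF n) → Dec (f ∼ g)
_∼?_ {n} f g = ∃Vec? (allFin n) ∈-allFin (λ σ → IsPerm? σ ×-dec (f ≟BF act σ g))

inSingleton? : ∀ {n} (f g : BF n) → Dec (g ≡ f)
inSingleton? f g = g ≟BF f

inClass? : ∀ {n} (f g : BF n) → Dec (g ∼ f)
inClass? f g = g ∼? f

γ : ∀ {n} → BF n → ℕ
γ {n} f = length (filter (λ g → g ∼? f) (D n))

InE : ∀ {n} → ℕ → BF n → Set
InE m f = m ∣ γ f

InE? : ∀ {n} (m : ℕ) → Decidable (InE {n} m)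
InE? m f = m ∣? γ f

PermInvariant : ∀ {n} → Pred (BF n) 0ℓ → Set
PermInvariant {n} Y = ∀ (σ : Perm n) → IsPerm σ →
  (∀ g → Y g → Y (act σ g)) × (∀ g → Y g → Σ (BF n) (λ h → Y h × g ≡ act σ h))

module Submission where

-- Permuting variables is an order automorphism of D_n fixing ⊤ and ⊥, so it preserves every
-- interval count re and hence G: G(πx, πy) = G(x, y). Reindexing the invariant set Y by π then
-- shows that the row sum G({x} × Y) depends only on the class [x], which gives (1) and (2).
-- E_{n,m} is a union of whole classes, each contributing γ times a common row sum, so m divides
-- G(E_{n,m} × Y); G(Y × E_{n,m}) is the same number because G is symmetric.

open import Defs
open import Algebra.Properties.CommutativeSemigroup as CSemigroupProperties using ()
open import Data.Bool using (Bool; true; false; _∨_; _∧_)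
open import Data.Bool.Properties using (∨-comm; ∧-comm)
open import Data.Empty using (⊥-elim)
open import Data.Fin using (Fin; punchOut)
open import Data.Fin.Properties using (any?; punchOut-injective; <⇒notInjective) renaming (_≟_ to _≟ᶠ_)
open import Data.List using (List; []; _∷_; map; filter; length)
open import Data.List.Properties using (filter-reject; filter-≐; length-filter; length-map; map-cong; map-∘)
open import Data.List.Membership.Propositional using (_∈_)
open import Data.List.Membership.Propositional.Properties
  using (∈-filter⁺; ∈-filter⁻; ∈-map⁺; ∈-map⁻; ∈-cartesianProduct⁺)
open import Data.List.Membership.Propositional.Properties.WithK using (unique∧set⇒bag)
open import Data.List.Relation.Binary.BagAndSetEquality using (∼bag⇒↭)
open import Data.List.Relation.Binary.Permutation.Propositional using (_↭_)
open import Data.List.Relation.Binary.Permutation.Propositional.Properties using (↭-length)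
import Data.List.Relation.Binary.Permutation.Propositional.Properties as ↭
open import Data.List.Relation.Unary.All as All using (All; []; _∷_)
open import Data.List.Relation.Unary.All.Properties using (all-filter)
import Data.List.Relation.Unary.All.Properties as AllProperties
open import Data.List.Relation.Unary.Any using (here)
open import Data.List.Relation.Unary.AllPairs using ([]; _∷_)
open import Data.List.Relation.Unary.Unique.Propositional using (Unique)
import Data.List.Relation.Unary.Unique.Propositional.Properties as Unique
open import Data.Nat using (ℕ; zero; suc; _+_; _*_; _≤_; _<_; s≤s)
open import Data.Nat.Divisibility using (_∣_; _∣0; ∣m∣n⇒∣m+n; ∣m⇒∣m*n)
open import Data.Nat.Induction using (<-wellFounded)
open import Data.Nat.ListAction using (sum)
open import Data.Nat.ListAction.Properties using (sum-↭)
open import Data.Nat.Properties using (+-assoc; +-identityʳ; *-zeroʳ; n<1+n; +-commutativeSemigroup)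
open import Data.Product using (Σ; ∃; _×_; _,_; proj₁; proj₂)
open import Data.Vec using ([]; _∷_; lookup; tabulate)
open import Data.Vec.Properties using (lookup∘tabulate; tabulate∘lookup; tabulate-cong)
open import Data.Vec.Relation.Binary.Pointwise.Inductive as Pointwise using ()
open import Function using (_∘_; id; _⇔_; mk⇔)
open import Induction.WellFounded using (Acc; acc)
open import Level using (0ℓ)
open import Relation.Binary using (Rel; IsEquivalence; IsDecEquivalence; _Preserves_⟶_)
open import Relation.Binary.PropositionalEquality
open import Relation.Nullary using (yes; no; ¬_)
open import Relation.Nullary.Decidable using (_×-dec_)
open import Relation.Unary using (Pred; Decidable; _⊆_)
open import Relation.Unary.Properties using (∁?)

open CSemigroupProperties +-commutativeSemigroup using (x∙yz≈y∙xz; interchange)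

module _ {A : Set} where

  unique-⇔⇒↭ : {xs ys : List A} → Unique xs → Unique ys → (∀ {z} → z ∈ xs ⇔ z ∈ ys) → xs ↭ ys
  unique-⇔⇒↭ xs! ys! xs⇔ys = ∼bag⇒↭ (unique∧set⇒bag xs! ys! xs⇔ys)

  sum-map-↭ : (f : A → ℕ) {xs ys : List A} → xs ↭ ys → sum (map f xs) ≡ sum (map f ys)
  sum-map-↭ f = sum-↭ ∘ ↭.map⁺ f

  sum-map-const : {f : A → ℕ} {c : ℕ} {xs : List A} → All (λ z → f z ≡ c) xs → sum (map f xs) ≡ length xs * c
  sum-map-const []             = refl
  sum-map-const (fz≡c ∷ f≡c) = cong₂ _+_ fz≡c (sum-map-const f≡c)

  sum-map-+ : (f g : A → ℕ) (xs : List A) → sum (map (λ z → f z + g z) xs) ≡ sum (map f xs) + sum (map g xs)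
  sum-map-+ f g []       = refl
  sum-map-+ f g (x ∷ xs) = trans (cong (f x + g x +_) (sum-map-+ f g xs)) (interchange (f x) (g x) _ _)

  sum-map-filter-∁ : (f : A → ℕ) {P : Pred A 0ℓ} (P? : Decidable P) (xs : List A) →
                     sum (map f xs) ≡ sum (map f (filter P? xs)) + sum (map f (filter (∁? P?) xs))
  sum-map-filter-∁ f P? []       = refl
  sum-map-filter-∁ f P? (x ∷ xs) with P? x
  ... | yes _ = trans (cong (f x +_) (sum-map-filter-∁ f P? xs)) (sym (+-assoc (f x) _ _))
  ... | no _  = trans (cong (f x +_) (sum-map-filter-∁ f P? xs))
                      (x∙yz≈y∙xz (f x) (sum (map f (filter P? xs))) (sum (map f (filter (∁? P?) xs))))

  filter-filter-⊆ : {P Q : Pred A 0ℓ} (P? : Decidable P) (Q? : Decidable Q) → P ⊆ Q →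
                    (xs : List A) → filter P? (filter Q? xs) ≡ filter P? xs
  filter-filter-⊆ P? Q? P⊆Q []       = refl
  filter-filter-⊆ P? Q? P⊆Q (x ∷ xs) with Q? x
  ... | no ¬Qx = trans (filter-filter-⊆ P? Q? P⊆Q xs) (sym (filter-reject P? (¬Qx ∘ P⊆Q)))
  ... | yes _ with P? x
  ...   | yes _ = cong (x ∷_) (filter-filter-⊆ P? Q? P⊆Q xs)
  ...   | no _  = filter-filter-⊆ P? Q? P⊆Q xs

module _ {A B : Set} where

  sum-map-sum-map-comm : (f : A → B → ℕ) (xs : List A) (ys : List B) →
    sum (map (λ x → sum (map (f x) ys)) xs) ≡ sum (map (λ y → sum (map (λ x → f x y) xs)) ys)
  sum-map-sum-map-comm f [] ys = sym (trans (sum-map-const (All.universal (λ _ → refl) ys)) (*-zeroʳ (length ys)))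
  sum-map-sum-map-comm f (x ∷ xs) ys =
    trans (cong (sum (map (f x) ys) +_) (sum-map-sum-map-comm f xs ys))
          (sym (sum-map-+ (f x) (λ y → sum (map (λ x → f x y) xs)) ys))

-- Removing the class of the head leaves the sizes of all other classes unchanged, so the
-- list splits into whole classes, each contributing (class size) * (common value).
module _ {A : Set} {_≈_ : Rel A 0ℓ} (≈-isDecEquivalence : IsDecEquivalence _≈_) where

  open IsDecEquivalence ≈-isDecEquivalence using (_≟_) renaming (refl to ≈-refl; sym to ≈-sym; trans to ≈-trans)

  classSize : A → List A → ℕ
  classSize z xs = length (filter (_≟ z) xs)

  ∣classSizes⇒∣sum-map : {m : ℕ} (f : A → ℕ) → f Preserves _≈_ ⟶ _≡_ → (xs : List A) →
                            All (λ z → m ∣ classSize z xs) xs → m ∣ sum (map f xs)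
  ∣classSizes⇒∣sum-map {m} f f-resp xs = go xs (<-wellFounded _)
    where
    go : (xs : List A) → Acc _<_ (length xs) → All (λ z → m ∣ classSize z xs) xs → m ∣ sum (map f xs)
    go []       _        _                         = m ∣0
    go (z ∷ xs) (acc rs) m∣classes@(m∣[z] ∷ _) =
      subst (m ∣_) (sym (sum-map-filter-∁ f (_≟ z) (z ∷ xs))) (∣m∣n⇒∣m+n m∣classOfHead m∣rest)
      where
      rest : List A
      rest = filter (∁? (_≟ z)) xs

      m∣classOfHead : m ∣ sum (map f (filter (_≟ z) (z ∷ xs)))
      m∣classOfHead = subst (m ∣_) (sym (sum-map-const (All.map f-resp (all-filter (_≟ z) (z ∷ xs)))))
                                   (∣m⇒∣m*n (f z) m∣[z])

      classSize-rest : ∀ {w} → ¬ w ≈ z → classSize w rest ≡ classSize w (z ∷ xs)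
      classSize-rest {w} w≉z = begin
        length (filter (_≟ w) rest)   ≡⟨ cong length (filter-filter-⊆ (_≟ w) (∁? (_≟ z)) (λ v≈w v≈z → w≉z (≈-trans (≈-sym v≈w) v≈z)) xs) ⟩
        length (filter (_≟ w) xs)     ≡⟨ cong length (sym (filter-reject (_≟ w) (w≉z ∘ ≈-sym))) ⟩
        classSize w (z ∷ xs)          ∎
        where open ≡-Reasoning

      m∣classes-rest : All (λ w → m ∣ classSize w rest) rest
      m∣classes-rest = All.zipWith (λ (w≉z , m∣[w]) → subst (m ∣_) (sym (classSize-rest w≉z)) m∣[w])
        (all-filter (∁? (_≟ z)) xs , AllProperties.filter⁺ (∁? (_≟ z)) (All.tail m∣classes))

      m∣rest : m ∣ sum (map f (filter (∁? (_≟ z)) (z ∷ xs)))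
      m∣rest = subst (λ ys → m ∣ sum (map f ys)) (sym (filter-reject (∁? (_≟ z)) (λ z≉z → z≉z ≈-refl)))
        (go rest (rs (s≤s (length-filter (∁? (_≟ z)) xs))) m∣classes-rest)

eval-tab : ∀ {n} (h : Input n → Bool) (u : Input n) → eval (tab h) u ≡ h u
eval-tab {zero}  h []          = refl
eval-tab {suc n} h (false ∷ u) = eval-tab (h ∘ (false ∷_)) u
eval-tab {suc n} h (true ∷ u)  = eval-tab (h ∘ (true ∷_)) u

tab-cong : ∀ {n} {h k : Input n → Bool} → (∀ u → h u ≡ k u) → tab h ≡ tab k
tab-cong {zero}  h≗k = h≗k []
tab-cong {suc n} h≗k = cong₂ _,_ (tab-cong (h≗k ∘ (false ∷_))) (tab-cong (h≗k ∘ (true ∷_)))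

BF-ext : ∀ {n} {f g : BF n} → (∀ u → eval f u ≡ eval g u) → f ≡ g
BF-ext {zero}  f≗g = f≗g []
BF-ext {suc n} f≗g = cong₂ _,_ (BF-ext (f≗g ∘ (false ∷_))) (BF-ext (f≗g ∘ (true ∷_)))

∣F-comm : ∀ {n} (f g : BF n) → f ∣F g ≡ g ∣F f
∣F-comm f g = tab-cong (λ u → ∨-comm (eval f u) (eval g u))

&F-comm : ∀ {n} (f g : BF n) → f &F g ≡ g &F f
&F-comm f g = tab-cong (λ u → ∧-comm (eval f u) (eval g u))

G-comm : ∀ {n} (f g : BF n) → G f g ≡ G g f
G-comm f g = cong₂ (λ j k → re j ⊤F * re ⊥F k) (∣F-comm f g) (&F-comm f g)

allBF-complete : ∀ n (f : BF n) → f ∈ allBF n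
allBF-complete zero    f         = bools-complete f
allBF-complete (suc n) (f₀ , f₁) = ∈-cartesianProduct⁺ (allBF-complete n f₀) (allBF-complete n f₁)

allBF-unique : ∀ n → Unique (allBF n)
allBF-unique zero    = ((λ ()) ∷ []) ∷ [] ∷ []
allBF-unique (suc n) = Unique.cartesianProduct⁺ (allBF-unique n) (allBF-unique n)

module _ {n : ℕ} {P : Pred (BF n) 0ℓ} (P? : Decidable P) where

  filter-D-unique : Unique (filter P? (D n))
  filter-D-unique = Unique.filter⁺ P? (Unique.filter⁺ Monotone? (allBF-unique n))

  ∈-filter-D⁺ : ∀ {f} → Monotone f → P f → f ∈ filter P? (D n)
  ∈-filter-D⁺ f-mono Pf = ∈-filter⁺ P? (∈-filter⁺ Monotone? (allBF-complete n _) f-mono) Pf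

  ∈-filter-D⁻ : ∀ {f} → f ∈ filter P? (D n) → Monotone f × P f
  ∈-filter-D⁻ f∈ with f∈D , Pf ← ∈-filter⁻ P? {xs = D n} f∈ = proj₂ (∈-filter⁻ Monotone? {xs = allBF n} f∈D) , Pf

_∘ₚ_ : ∀ {n} → Perm n → Perm n → Perm n
σ ∘ₚ τ = tabulate (λ i → lookup σ (lookup τ i))

idₚ : ∀ {n} → Perm n
idₚ = tabulate id

isPerm-idₚ : ∀ {n} → IsPerm (idₚ {n})
isPerm-idₚ i j e = trans (sym (lookup∘tabulate id i)) (trans e (lookup∘tabulate id j))

isPerm-∘ₚ : ∀ {n} (σ τ : Perm n) → IsPerm σ → IsPerm τ → IsPerm (σ ∘ₚ τ)
isPerm-∘ₚ σ τ σ-perm τ-perm i j e =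
  τ-perm i j (σ-perm _ _ (trans (sym (lookup∘tabulate _ i)) (trans e (lookup∘tabulate _ j))))

-- A missed value would let punchOut turn σ into an injection Fin (1 + n) → Fin n.
isPerm-surjective : ∀ {n} (σ : Perm n) → IsPerm σ → ∀ j → ∃ λ i → lookup σ i ≡ j
isPerm-surjective {suc n} σ σ-perm j with any? (λ i → lookup σ i ≟ᶠ j)
... | yes found = found
... | no missed = ⊥-elim (<⇒notInjective {f = σ⁻} (n<1+n n) (λ {i} {k} e → σ-perm i k (punchOut-injective (j∉σ i) (j∉σ k) e)))
  where
  j∉σ : ∀ i → j ≢ lookup σ i
  j∉σ i e = missed (i , sym e)

  σ⁻ : Fin (suc n) → Fin n
  σ⁻ i = punchOut (j∉σ i)

inverseₚ : ∀ {n} (σ : Perm n) → IsPerm σ → Perm n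
inverseₚ σ σ-perm = tabulate (proj₁ ∘ isPerm-surjective σ σ-perm)

module _ {n} (σ : Perm n) (σ-perm : IsPerm σ) where

  inverseₚʳ : ∀ j → lookup σ (lookup (inverseₚ σ σ-perm) j) ≡ j
  inverseₚʳ j = trans (cong (lookup σ) (lookup∘tabulate _ j)) (proj₂ (isPerm-surjective σ σ-perm j))

  inverseₚˡ : ∀ i → lookup (inverseₚ σ σ-perm) (lookup σ i) ≡ i
  inverseₚˡ i = σ-perm _ _ (inverseₚʳ (lookup σ i))

  isPerm-inverseₚ : IsPerm (inverseₚ σ σ-perm)
  isPerm-inverseₚ i j e = trans (sym (inverseₚʳ i)) (trans (cong (lookup σ) e) (inverseₚʳ j))

module _ {n : ℕ} where

  act-eval : (σ : Perm n) (g : BF n) (u : Input n) → eval (act σ g) u ≡ eval g (actI σ u)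
  act-eval σ g = eval-tab (eval g ∘ actI σ)

  actI-∘ₚ : (σ τ : Perm n) (u : Input n) → actI τ (actI σ u) ≡ actI (σ ∘ₚ τ) u
  actI-∘ₚ σ τ u = tabulate-cong λ i → begin
    lookup (actI σ u) (lookup τ i)     ≡⟨ lookup∘tabulate _ (lookup τ i) ⟩
    lookup u (lookup σ (lookup τ i))   ≡⟨ cong (lookup u) (sym (lookup∘tabulate _ i)) ⟩
    lookup u (lookup (σ ∘ₚ τ) i)       ∎
    where open ≡-Reasoning

  act-∘ₚ : (σ τ : Perm n) (g : BF n) → act σ (act τ g) ≡ act (σ ∘ₚ τ) g
  act-∘ₚ σ τ g = tab-cong λ u → trans (act-eval τ g (actI σ u)) (cong (eval g) (actI-∘ₚ σ τ u))

  act-fixing : (σ : Perm n) → (∀ i → lookup σ i ≡ i) → (g : BF n) → act σ g ≡ g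
  act-fixing σ σ≗id g = BF-ext λ u →
    trans (act-eval σ g u) (cong (eval g) (trans (tabulate-cong (cong (lookup u) ∘ σ≗id)) (tabulate∘lookup u)))

  act-cancel : (σ τ : Perm n) → (∀ i → lookup σ (lookup τ i) ≡ i) → (g : BF n) → act σ (act τ g) ≡ g
  act-cancel σ τ στ≗id g = trans (act-∘ₚ σ τ g) (act-fixing (σ ∘ₚ τ) (λ i → trans (lookup∘tabulate _ i) (στ≗id i)) g)

  act-injective : (σ : Perm n) → IsPerm σ → ∀ {g h} → act σ g ≡ act σ h → g ≡ h
  act-injective σ σ-perm {g} {h} σg≡σh = begin
    g                     ≡⟨ sym (act-cancel τ σ (inverseₚˡ σ σ-perm) g) ⟩
    act τ (act σ g)       ≡⟨ cong (act τ) σg≡σh ⟩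
    act τ (act σ h)       ≡⟨ act-cancel τ σ (inverseₚˡ σ σ-perm) h ⟩
    h                     ∎
    where
    open ≡-Reasoning
    τ = inverseₚ σ σ-perm

  ∼-isEquivalence : IsEquivalence (_∼_ {n})
  ∼-isEquivalence = record
    { refl  = λ {f} → idₚ , isPerm-idₚ , sym (act-fixing idₚ (lookup∘tabulate id) f)
    ; sym   = λ { (σ , σ-perm , refl) → let τ = inverseₚ σ σ-perm in
                τ , isPerm-inverseₚ σ σ-perm , sym (act-cancel τ σ (inverseₚˡ σ σ-perm) _) }
    ; trans = λ { (σ , σ-perm , refl) (τ , τ-perm , refl) →
                σ ∘ₚ τ , isPerm-∘ₚ σ τ σ-perm τ-perm , act-∘ₚ σ τ _ }
    }

  ∼-isDecEquivalence : IsDecEquivalence (_∼_ {n})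
  ∼-isDecEquivalence = record { isEquivalence = ∼-isEquivalence ; _≟_ = _∼?_ }

  open IsEquivalence ∼-isEquivalence using () renaming (sym to ∼-sym; trans to ∼-trans)

  actI-mono : (σ : Perm n) {u v : Input n} → u ≤ᵛ v → actI σ u ≤ᵛ actI σ v
  actI-mono σ u≤v = Pointwise.tabulate⁺ (λ i → Pointwise.lookup u≤v (lookup σ i))

  act-monotone : (σ : Perm n) {g : BF n} → Monotone g → Monotone (act σ g)
  act-monotone σ {g} g-mono u v u≤v
    rewrite act-eval σ g u | act-eval σ g v = g-mono _ _ (actI-mono σ u≤v)

  act-≤F : (σ : Perm n) {f g : BF n} → f ≤F g → act σ f ≤F act σ g
  act-≤F σ {f} {g} f≤g u rewrite act-eval σ f u | act-eval σ g u = f≤g (actI σ u)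

  act-tab : (σ : Perm n) (h : Input n → Bool) → act σ (tab h) ≡ tab (h ∘ actI σ)
  act-tab σ h = tab-cong (eval-tab h ∘ actI σ)

  act-∣F : (σ : Perm n) (f g : BF n) → act σ (f ∣F g) ≡ act σ f ∣F act σ g
  act-∣F σ f g = trans (act-tab σ _) (tab-cong λ u → sym (cong₂ _∨_ (act-eval σ f u) (act-eval σ g u)))

  act-&F : (σ : Perm n) (f g : BF n) → act σ (f &F g) ≡ act σ f &F act σ g
  act-&F σ f g = trans (act-tab σ _) (tab-cong λ u → sym (cong₂ _∧_ (act-eval σ f u) (act-eval σ g u)))


  filter-D-↭-map-act : (σ : Perm n) → IsPerm σ → {P Q : Pred (BF n) 0ℓ} (P? : Decidable P) (Q? : Decidable Q) →
    (∀ g → Monotone g → P g → Q (act σ g)) →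
    (∀ g → Monotone g → Q g → Σ (BF n) λ h → P h × g ≡ act σ h) →
    filter Q? (D n) ↭ map (act σ) (filter P? (D n))
  filter-D-↭-map-act σ σ-perm P? Q? P⇒Q∘σ Q⇒P∘σ⁻ =
    unique-⇔⇒↭ (filter-D-unique Q?) (Unique.map⁺ (act-injective σ σ-perm) (filter-D-unique P?)) (mk⇔ to from)
    where
    to : ∀ {g} → g ∈ filter Q? (D n) → g ∈ map (act σ) (filter P? (D n))
    to g∈ with g-mono , Qg ← ∈-filter-D⁻ Q? g∈ with h , Ph , refl ← Q⇒P∘σ⁻ _ g-mono Qg =
      ∈-map⁺ (act σ) (∈-filter-D⁺ P? h-mono Ph)
      where
      τ = inverseₚ σ σ-perm

      h-mono : Monotone h
      h-mono = subst Monotone (act-cancel τ σ (inverseₚˡ σ σ-perm) h) (act-monotone τ g-mono)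

    from : ∀ {g} → g ∈ map (act σ) (filter P? (D n)) → g ∈ filter Q? (D n)
    from g∈ with h , h∈ , refl ← ∈-map⁻ (act σ) g∈ with h-mono , Ph ← ∈-filter-D⁻ P? h∈ =
      ∈-filter-D⁺ Q? (act-monotone σ h-mono) (P⇒Q∘σ _ h-mono Ph)

  between? : (a b : BF n) → Decidable (λ z → a ≤F z × z ≤F b)
  between? a b z = (a ≤F? z) ×-dec (z ≤F? b)

  re-act : (σ : Perm n) → IsPerm σ → (a b : BF n) → re (act σ a) (act σ b) ≡ re a b
  re-act σ σ-perm a b =
    trans (↭-length (filter-D-↭-map-act σ σ-perm (between? a b) (between? (act σ a) (act σ b)) fwd bwd))
          (length-map (act σ) (filter (between? a b) (D n)))
    where
    τ = inverseₚ σ σ-perm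
    τσ≗id = inverseₚˡ σ σ-perm

    fwd : ∀ g → Monotone g → a ≤F g × g ≤F b → act σ a ≤F act σ g × act σ g ≤F act σ b
    fwd g _ (a≤g , g≤b) = act-≤F σ a≤g , act-≤F σ g≤b

    bwd : ∀ g → Monotone g → act σ a ≤F g × g ≤F act σ b → Σ (BF n) λ h → (a ≤F h × h ≤F b) × g ≡ act σ h
    bwd g _ (σa≤g , g≤σb) =
      act τ g ,
      (subst (_≤F act τ g) (act-cancel τ σ τσ≗id a) (act-≤F τ σa≤g) ,
       subst (act τ g ≤F_) (act-cancel τ σ τσ≗id b) (act-≤F τ g≤σb)) ,
      sym (act-cancel σ τ (inverseₚʳ σ σ-perm) g)

  G-act : (σ : Perm n) → IsPerm σ → (f g : BF n) → G (act σ f) (act σ g) ≡ G f g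
  G-act σ σ-perm f g = cong₂ _*_
    (begin
      re (act σ f ∣F act σ g) ⊤F        ≡⟨ cong₂ re (sym (act-∣F σ f g)) (sym (act-tab σ _)) ⟩
      re (act σ (f ∣F g)) (act σ ⊤F)    ≡⟨ re-act σ σ-perm _ _ ⟩
      re (f ∣F g) ⊤F                    ∎)
    (begin
      re ⊥F (act σ f &F act σ g)        ≡⟨ cong₂ re (sym (act-tab σ _)) (sym (act-&F σ f g)) ⟩
      re (act σ ⊥F) (act σ (f &F g))    ≡⟨ re-act σ σ-perm _ _ ⟩
      re ⊥F (f &F g)                    ∎)
    where open ≡-Reasoning

  γ-resp-∼ : {f g : BF n} → f ∼ g → γ f ≡ γ g
  γ-resp-∼ f∼g = cong length
    (filter-≐ (_∼? _) (_∼? _) ((λ h∼f → ∼-trans h∼f f∼g) , (λ h∼g → ∼-trans h∼g (∼-sym f∼g))) (D n))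

GΣ-comm : ∀ {n} {P Q : Pred (BF n) 0ℓ} (P? : Decidable P) (Q? : Decidable Q) → GΣ P? Q? ≡ GΣ Q? P?
GΣ-comm {n} P? Q? = begin
  sum (map (λ f → sum (map (G f) (filter Q? (D n)))) (filter P? (D n)))
    ≡⟨ sum-map-sum-map-comm G (filter P? (D n)) (filter Q? (D n)) ⟩
  sum (map (λ g → sum (map (λ f → G f g) (filter P? (D n)))) (filter Q? (D n)))
    ≡⟨ cong sum (map-cong (λ g → cong sum (map-cong (λ f → G-comm f g) (filter P? (D n)))) (filter Q? (D n))) ⟩
  sum (map (λ g → sum (map (G g) (filter P? (D n)))) (filter Q? (D n)))
    ∎
  where open ≡-Reasoning

module _ {n : ℕ} {Y : Pred (BF n) 0ℓ} (Y? : Decidable Y) where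

  G-row : BF n → ℕ
  G-row f = sum (map (G f) (filter Y? (D n)))

  GΣ-singleton : {f : BF n} → Monotone f → GΣ (inSingleton? f) Y? ≡ G-row f
  GΣ-singleton {f} f-mono =
    trans (sum-map-↭ G-row (unique-⇔⇒↭ (filter-D-unique (inSingleton? f)) ([] ∷ []) (mk⇔ to from)))
          (+-identityʳ (G-row f))
    where
    to : ∀ {g} → g ∈ filter (inSingleton? f) (D n) → g ∈ f ∷ []
    to g∈ = here (proj₂ (∈-filter-D⁻ (inSingleton? f) g∈))

    from : ∀ {g} → g ∈ f ∷ [] → g ∈ filter (inSingleton? f) (D n)
    from (here refl) = ∈-filter-D⁺ (inSingleton? f) f-mono refl

  module _ (Y-invariant : PermInvariant Y) where

    G-row-act : (σ : Perm n) → IsPerm σ → (f : BF n) → G-row (act σ f) ≡ G-row f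
    G-row-act σ σ-perm f = begin
      sum (map (G (act σ f)) (filter Y? (D n)))
        ≡⟨ sum-map-↭ (G (act σ f)) (filter-D-↭-map-act σ σ-perm Y? Y? (λ g _ → Yσ g) (λ g _ → Yσ⁻ g)) ⟩
      sum (map (G (act σ f)) (map (act σ) (filter Y? (D n))))
        ≡⟨ cong sum (sym (map-∘ (filter Y? (D n)))) ⟩
      sum (map (G (act σ f) ∘ act σ) (filter Y? (D n)))
        ≡⟨ cong sum (map-cong (G-act σ σ-perm f) (filter Y? (D n))) ⟩
      sum (map (G f) (filter Y? (D n)))
        ∎
      where
      open ≡-Reasoning
      Yσ  = proj₁ (Y-invariant σ σ-perm)
      Yσ⁻ = proj₂ (Y-invariant σ σ-perm)

    G-row-resp-∼ : G-row Preserves _∼_ ⟶ _≡_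
    G-row-resp-∼ (σ , σ-perm , refl) = G-row-act σ σ-perm _

    GΣ-class : (f : BF n) → GΣ (inClass? f) Y? ≡ γ f * G-row f
    GΣ-class f = sum-map-const (All.map G-row-resp-∼ (all-filter (inClass? f) (D n)))

    -- The class of f inside E is all of [f], since γ is constant on classes.
    ∣GΣ-E : (m : ℕ) → m ∣ GΣ (InE? m) Y?
    ∣GΣ-E m = ∣classSizes⇒∣sum-map ∼-isDecEquivalence G-row G-row-resp-∼ (filter (InE? m) (D n))
      (All.map ∣classSize (all-filter (InE? m) (D n)))
      where
      ∣classSize : ∀ {f} → m ∣ γ f → m ∣ classSize ∼-isDecEquivalence f (filter (InE? m) (D n))
      ∣classSize {f} m∣γf = subst (m ∣_)
        (sym (cong length (filter-filter-⊆ (_∼? f) (InE? m) (λ g∼f → subst (m ∣_) (sym (γ-resp-∼ g∼f)) m∣γf) (D n))))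
        m∣γf

lemma4 : (n m : ℕ) → 2 ≤ m →
    (Y : Pred (BF n) 0ℓ) (Y? : Decidable Y) → (∀ g → Y g → Monotone g) → PermInvariant Y →
    (x y : BF n) → Monotone x → Monotone y → x ∼ y →
    (GΣ (inSingleton? x) Y? ≡ GΣ (inSingleton? y) Y?)
    × (GΣ (inClass? x) Y? ≡ γ x * GΣ (inSingleton? x) Y?)
    × (m ∣ γ x → m ∣ GΣ (inClass? x) Y?)
    × (m ∣ GΣ (InE? m) Y? × m ∣ GΣ Y? (InE? m))
lemma4 n m _ Y Y? _ Y-invariant x y x-mono y-mono x∼y =
  singletons-equal , class-sum , ∣class-sum , ∣GΣ-E Y? Y-invariant m , ∣GΣ-E-right
  where
  singletons-equal : GΣ (inSingleton? x) Y? ≡ GΣ (inSingleton? y) Y?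
  singletons-equal = begin
    GΣ (inSingleton? x) Y?  ≡⟨ GΣ-singleton Y? x-mono ⟩
    G-row Y? x              ≡⟨ G-row-resp-∼ Y? Y-invariant x∼y ⟩
    G-row Y? y              ≡⟨ GΣ-singleton Y? y-mono ⟨
    GΣ (inSingleton? y) Y?  ∎
    where open ≡-Reasoning

  class-sum : GΣ (inClass? x) Y? ≡ γ x * GΣ (inSingleton? x) Y?
  class-sum = trans (GΣ-class Y? Y-invariant x) (cong (γ x *_) (sym (GΣ-singleton Y? x-mono)))

  ∣class-sum : m ∣ γ x → m ∣ GΣ (inClass? x) Y?
  ∣class-sum m∣γx = subst (m ∣_) (sym class-sum) (∣m⇒∣m*n _ m∣γx)

  ∣GΣ-E-right : m ∣ GΣ Y? (InE? m)
  ∣GΣ-E-right = subst (m ∣_) (GΣ-comm (InE? m) Y?) (∣GΣ-E Y? Y-invariant m)
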